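{- Let $n\in\mathbb{N}$ and let the symmetric group $S_n$ act on the faces of the permutohedron $P(n)$ by permuting coordinates. Two faces of $P(n)$ are in the same orbit if and only if their corresponding unit-interval parking function labels have the same ordered prime decomposition, i.e. the same sequence of lengths of component primes (in order).
   Context: $P(n)=\operatorname{conv}\{(w(1),\dots,w(n)): w\text{ a permutation of }[n]\}$. For an ordered set partition $B_1/\cdots/B_k$ of $[n]$ (ordered list of disjoint nonempty blocks with union $[n]$), $F_{B_1/\cdots/B_k}$ is the face of $P(n)$ spanned by the vertices $x$ with $x_i<x_j$ whenever $i\in B_a,j\in B_b,a<b$; every face arises uniquely this way. The unit-interval parking function label of the face $F_{B_1/\cdots/B_k}$ is $\psi(B_1/\cdots/B_k)=(\alpha_1,\dots,\alpha_n)$, where for each block $B_a=\{c_1<\dots<c_m\}$ with $s=|B_1|+\dots+|B_{a-1}|$ we set $\alpha_{c_1}=s+1$ and $\alpha_{c_t}=s+t-1$ for $2\le t\le m$. A parking function $\alpha$ of length $n$ (cars $1,\dots,n$ with preferences $a_i$ park in order, each in the first free spot $\ge a_i$, all cars parking in spots $1,\dots,n$) has a breakpoint at $k$ if $|\{i:a_i\le k\}|=k$; for a unit-interval parking function (each car parks at most one spot past its preference) with breakpoints $b_1<\dots<b_k=n$ ($b_0=0$), its component primes, in order, have lengths $b_1-b_0,\dots,b_k-b_{k-1}$, and its ordered prime decomposition is this ordered list of component primes (each of length $r$ equal to $(1,1,2,\dots,r-1)$). -}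

module Defs where

open import Data.Nat using (ℕ; zero; suc; _+_; _∸_; _≤_; _<_; _≤?_; _<?_; _≟_)
open import Data.Fin using (Fin; toℕ)
import Data.Fin as F
open import Data.Fin.Permutation using (Permutation′; _⟨$⟩ʳ_; _⟨$⟩ˡ_; inverseˡ)
open import Data.List using (List; []; _∷_; length; filter; allFin; map; upTo; applyUpTo)
open import Data.Product using (Σ; ∃; _,_; _×_)
open import Relation.Nullary using (Dec; yes; no; _×-dec_)
open import Relation.Binary.PropositionalEquality using (_≡_; refl; trans; cong)

count : ∀ {n} (P : Fin n → Set) → (∀ i → Dec (P i)) → ℕ
count {n} P P? = length (filter P? (allFin n))

-- An ordered set partition B_1/…/B_k of [n], encoded by the (surjective)
-- map sending each element to the index of its block (blocks indexed 0..k-1,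
-- block index a corresponds to B_{a+1}).  Surjectivity = all blocks nonempty.
record OSP (n : ℕ) : Set where
  field
    k         : ℕ
    blockOf   : Fin n → Fin k
    surjective : ∀ (b : Fin k) → ∃ λ i → blockOf i ≡ b
open OSP public

_≈OSP_ : ∀ {n} → OSP n → OSP n → Set
P ≈OSP Q = (k P ≡ k Q) × (∀ i → toℕ (blockOf P i) ≡ toℕ (blockOf Q i))

-- Action of σ ∈ S_n on faces by permuting coordinates:
-- σ · F_{B_1/…/B_k} = F_{σ(B_1)/…/σ(B_k)}, i.e. σ(i) lies in the block of i.
act : ∀ {n} → Permutation′ n → OSP n → OSP n
act σ P = record
  { k = k P
  ; blockOf = λ j → blockOf P (σ ⟨$⟩ˡ j)
  ; surjective = λ b → go b (surjective P b)
  }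
  where
  go : ∀ b → (∃ λ i → blockOf P i ≡ b) → ∃ λ j → blockOf P (σ ⟨$⟩ˡ j) ≡ b
  go b (i , e) = σ ⟨$⟩ʳ i , trans (cong (blockOf P) (inverseˡ σ)) e

SameOrbit : ∀ {n} → OSP n → OSP n → Set
SameOrbit {n} P Q = Σ (Permutation′ n) λ σ → act σ P ≈OSP Q

-- The unit-interval parking function label ψ(B_1/…/B_k) = (α_1,…,α_n).
-- For c in block B_a: s = |B_1|+…+|B_{a-1}|, and t-1 = #{d ∈ B_a : d < c}.
-- α_c = s+1 if t = 1, and α_c = s+t-1 if t ≥ 2.
ψ : ∀ {n} → OSP n → (Fin n → ℕ)
ψ P c with count (λ d → toℕ (blockOf P d) < toℕ (blockOf P c))
                 (λ d → toℕ (blockOf P d) <? toℕ (blockOf P c))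
          | count (λ d → (toℕ (blockOf P d) ≡ toℕ (blockOf P c)) × (toℕ d < toℕ c))
                 (λ d → (toℕ (blockOf P d) ≟ toℕ (blockOf P c)) ×-dec (toℕ d <? toℕ c))
... | s | zero  = s + 1
... | s | suc r = s + suc r

isBreakpoint : ∀ {n} → (Fin n → ℕ) → ℕ → Set
isBreakpoint α m = count (λ i → α i ≤ m) (λ i → α i ≤? m) ≡ m

breakpoints : ∀ {n} → (Fin n → ℕ) → List ℕ
breakpoints {n} α = filter (λ m → count (λ i → α i ≤ m) (λ i → α i ≤? m) ≟ m)
                           (applyUpTo suc n)

diffsFrom : ℕ → List ℕ → List ℕ
diffsFrom prev [] = []
diffsFrom prev (b ∷ bs) = (b ∸ prev) ∷ diffsFrom b bs

primeLengths : ∀ {n} → (Fin n → ℕ) → List ℕ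
primeLengths α = diffsFrom 0 (breakpoints α)

prime : ℕ → List ℕ
prime r = 1 ∷ applyUpTo suc (r ∸ 1)

orderedPrimeDecomposition : ∀ {n} → (Fin n → ℕ) → List (List ℕ)
orderedPrimeDecomposition α = map prime (primeLengths α)

-- List [n] block by block, each block in increasing order, and call the place (from 0) of c in
-- this list its position.  The label ψ(c) is position c + 1 when c is the least element of its
-- block and position c otherwise.  Since position is a bijection onto {0,…,n-1}, for m ≤ n
-- exactly m + #{c at position m, c not least in its block} labels are ≤ m; so the breakpoints are
-- the partial sums |B₁| + ⋯ + |B_a|, and the component primes have lengths |B₁|, …, |B_k|.  As
-- the list (1,1,2,…,r-1) has length r, the ordered prime decomposition is the same datum as the
-- sequence of block sizes.  Permuting coordinates preserves that sequence; conversely, if P and Q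
-- have the same block sizes, the permutation sending the element at each position for P to the
-- element at the same position for Q carries P to Q.
module Submission where

open import Defs
open import Data.Empty using (⊥-elim)
open import Data.Fin as Fin using (Fin; toℕ; fromℕ<; punchOut)
open import Data.Fin.Permutation
  using (Permutation′; _⟨$⟩ʳ_; _⟨$⟩ˡ_; permutation; flip; _∘ₚ_; inverseʳ)
open import Data.Fin.Properties
  using (toℕ-injective; toℕ-fromℕ<; fromℕ<-injective; toℕ<n; any?; punchOut-injective;
         injective⇒≤)
  renaming (_≟_ to _≟ᶠ_)
open import Data.List
  using (List; []; _∷_; length; filter; tabulate; allFin; applyUpTo; map; _++_)
open import Data.List.Properties
  using (filter-++; filter-accept; filter-reject; filter-all; filter-none; filter-some;
         length-filter; length-tabulate; length-applyUpTo; ∷-injective)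
open import Data.List.Relation.Unary.All using (All; []; _∷_)
import Data.List.Relation.Unary.All.Properties as All
import Data.List.Relation.Unary.Any.Properties as Any
open import Data.Nat
  using (ℕ; zero; suc; _+_; _∸_; _≤_; _<_; _≤?_; _<?_; _≟_; s≤s; s≤s⁻¹; z<s; s<s)
open import Data.Nat.ListAction using (sum)
open import Data.Nat.Properties
open import Algebra.Properties.CommutativeMonoid.Sum +-0-commutativeMonoid
  using (sum-syntax; sum-cong-≗; sum-permute; ∑-distrib-+)
open import Data.Product using (∃; _,_; _×_; proj₁; proj₂)
open import Data.Sum using (_⊎_; inj₁; inj₂; [_,_]′; map₂)
open import Function using (_∘_; id; Injective; _⇔_; mk⇔; Equivalence)
open import Level using (0ℓ)
open import Relation.Binary.Core using (_Preserves_⟶_)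
open import Relation.Binary.Definitions using (tri<; tri≈; tri>)
open import Relation.Binary.PropositionalEquality
open import Relation.Nullary using (Dec; yes; no; ¬_; contradiction; _×-dec_)
open import Relation.Unary using (Pred; Decidable; _⊆_; _≐_; _∪_; _∩_; ∁; ∅)
open import Relation.Unary.Properties using (_∩?_; ∁?)

private variable
  A B C : Set

-- Counting

indicator : Dec A → ℕ
indicator (yes _) = 1
indicator (no _)  = 0

indicator-cong : (A? : Dec A) (B? : Dec B) → (A → B) → (B → A) → indicator A? ≡ indicator B?
indicator-cong (yes _) (yes _)  _  _    = refl
indicator-cong (no _)  (no _)   _  _    = refl
indicator-cong (yes a) (no ¬b)  to _    = contradiction (to a) ¬b
indicator-cong (no ¬a) (yes b)  _  from = contradiction (from b) ¬a

indicator-⊎ : (C? : Dec C) (A? : Dec A) (B? : Dec B) →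
  (C → A ⊎ B) → (A ⊎ B → C) → (A → ¬ B) → indicator C? ≡ indicator A? + indicator B?
indicator-⊎ (yes _) (yes a) (yes b) _  _    disj = contradiction b (disj a)
indicator-⊎ (yes _) (yes _) (no _)  _  _    _    = refl
indicator-⊎ (yes _) (no _)  (yes _) _  _    _    = refl
indicator-⊎ (yes c) (no ¬a) (no ¬b) to _    _    = ⊥-elim ([ ¬a , ¬b ]′ (to c))
indicator-⊎ (no ¬c) (yes a) _       _  from _    = contradiction (from (inj₁ a)) ¬c
indicator-⊎ (no ¬c) (no _)  (yes b) _  from _    = contradiction (from (inj₂ b)) ¬c
indicator-⊎ (no _)  (no _)  (no _)  _  _    _    = refl

length-filter-tabulate : ∀ {n} {P : Pred A 0ℓ} (P? : Decidable P) (f : Fin n → A) →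
  length (filter P? (tabulate f)) ≡ ∑[ i < n ] indicator (P? (f i))
length-filter-tabulate {n = zero}  P? f = refl
length-filter-tabulate {n = suc n} P? f with P? (f Fin.zero)
... | yes _ = cong suc (length-filter-tabulate P? (f ∘ Fin.suc))
... | no _  = length-filter-tabulate P? (f ∘ Fin.suc)

module _ {n : ℕ} where

  private variable
    P Q R : Pred (Fin n) 0ℓ

  count≡∑ : (P? : Decidable P) → count P P? ≡ ∑[ i < n ] indicator (P? i)
  count≡∑ P? = length-filter-tabulate P? id

  count-cong : (P? : Decidable P) (Q? : Decidable Q) → P ≐ Q → count P P? ≡ count Q Q?
  count-cong P? Q? (P⊆Q , Q⊆P) rewrite count≡∑ P? | count≡∑ Q? =
    sum-cong-≗ (λ i → indicator-cong (P? i) (Q? i) P⊆Q Q⊆P)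

  count-permute : (P? : Decidable P) (π : Permutation′ n) →
    count (λ i → P (π ⟨$⟩ʳ i)) (λ i → P? (π ⟨$⟩ʳ i)) ≡ count P P?
  count-permute P? π rewrite count≡∑ P? | count≡∑ (λ i → P? (π ⟨$⟩ʳ i)) =
    sym (sum-permute (indicator ∘ P?) π)

  count-disjoint-∪ : (R? : Decidable R) (P? : Decidable P) (Q? : Decidable Q) →
    R ≐ P ∪ Q → P ∩ Q ⊆ ∅ → count R R? ≡ count P P? + count Q Q?
  count-disjoint-∪ R? P? Q? (R⊆P∪Q , P∪Q⊆R) disjoint
    rewrite count≡∑ R? | count≡∑ P? | count≡∑ Q? =
    trans (sum-cong-≗ indicator-split) (∑-distrib-+ (indicator ∘ P?) (indicator ∘ Q?))
    where
    indicator-split : ∀ i → indicator (R? i) ≡ indicator (P? i) + indicator (Q? i)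
    indicator-split i =
      indicator-⊎ (R? i) (P? i) (Q? i) R⊆P∪Q P∪Q⊆R (λ p q → disjoint (p , q))

  count-none : (P? : Decidable P) → (∀ i → ¬ P i) → count P P? ≡ 0
  count-none P? none = cong length (filter-none P? (All.tabulate⁺ none))

  count-all : (P? : Decidable P) → (∀ i → P i) → count P P? ≡ n
  count-all P? all = trans (cong length (filter-all P? (All.tabulate⁺ all))) (length-tabulate id)

  count-≤ : (P? : Decidable P) → count P P? ≤ n
  count-≤ P? = ≤-trans (length-filter P? (allFin n)) (≤-reflexive (length-tabulate id))

  count-pos : (P? : Decidable P) → ∀ {i} → P i → 0 < count P P?
  count-pos P? {i} Pi = filter-some P? (Any.tabulate⁺ i Pi)

  count-⊆-split : (P? : Decidable P) (Q? : Decidable Q) → P ⊆ Q →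
    count Q Q? ≡ count P P? + count (Q ∩ ∁ P) (Q? ∩? ∁? P?)
  count-⊆-split {P} {Q} P? Q? P⊆Q =
    count-disjoint-∪ Q? P? (Q? ∩? ∁? P?) (split , [ P⊆Q , proj₁ ]′) (λ (p , _ , ¬p) → ¬p p)
    where
    split : Q ⊆ P ∪ (Q ∩ ∁ P)
    split {i} q with P? i
    ... | yes p = inj₁ p
    ... | no ¬p = inj₂ (q , ¬p)

  count-mono : (P? : Decidable P) (Q? : Decidable Q) → P ⊆ Q → count P P? ≤ count Q Q?
  count-mono P? Q? P⊆Q = subst (_ ≤_) (sym (count-⊆-split P? Q? P⊆Q)) (m≤m+n _ _)

  count-strict : (P? : Decidable P) (Q? : Decidable Q) → P ⊆ Q →
    ∀ {i} → Q i → ¬ P i → count P P? < count Q Q?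
  count-strict P? Q? P⊆Q Qi ¬Pi = subst (_ <_) (sym (count-⊆-split P? Q? P⊆Q))
    (m<m+n _ (count-pos (Q? ∩? ∁? P?) (Qi , ¬Pi)))

count-suc : ∀ {n} {P : Pred (Fin (suc n)) 0ℓ} (P? : Decidable P) →
  count P P? ≡ indicator (P? Fin.zero) + count (P ∘ Fin.suc) (P? ∘ Fin.suc)
count-suc P? =
  trans (count≡∑ P?) (cong (indicator (P? Fin.zero) +_) (sym (count≡∑ (P? ∘ Fin.suc))))

count-toℕ< : ∀ {n m} → m ≤ n → count (λ (i : Fin n) → toℕ i < m) (λ i → toℕ i <? m) ≡ m
count-toℕ< {n}     {zero}  _          = count-none (λ (i : Fin n) → toℕ i <? 0) (λ _ ())
count-toℕ< {suc n} {suc m} (s≤s m≤n) =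
  trans (count-suc (λ (i : Fin (suc n)) → toℕ i <? suc m)) (cong suc
    (trans (count-cong (λ (i : Fin n) → suc (toℕ i) <? suc m) (λ i → toℕ i <? m) (s≤s⁻¹ , s≤s))
           (count-toℕ< m≤n)))

injective⇒surjective : ∀ {n} {f : Fin n → Fin n} → Injective _≡_ _≡_ f → ∀ y → ∃ λ x → f x ≡ y
injective⇒surjective {suc n} {f} f-injective y with any? (λ x → f x ≟ᶠ y)
... | yes found = found
... | no ¬found = contradiction (injective⇒≤ punchOut-f-injective) 1+n≰n
  where
  y≢f : ∀ x → y ≢ f x
  y≢f x y≡fx = ¬found (x , sym y≡fx)
  punchOut-f-injective : Injective _≡_ _≡_ (λ x → punchOut (y≢f x))
  punchOut-f-injective eq = f-injective (punchOut-injective (y≢f _) (y≢f _) eq)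

injection⇒permutation : ∀ {n} (f : Fin n → Fin n) → Injective _≡_ _≡_ f → Permutation′ n
injection⇒permutation f f-injective =
  permutation f (proj₁ ∘ f-surjective) (proj₂ ∘ f-surjective)
    (λ x → f-injective (proj₂ (f-surjective (f x))))
  where
  f-surjective = injective⇒surjective f-injective

step-unique : ∀ {f : ℕ → ℕ} → f Preserves _≤_ ⟶ _≤_ → ∀ {a b x} →
  f a ≤ x → x < f (suc a) → f b ≤ x → x < f (suc b) → a ≡ b
step-unique mono fa≤x x<fa+1 fb≤x x<fb+1 with <-cmp _ _
... | tri< a<b _ _ = contradiction (<-≤-trans x<fa+1 (≤-trans (mono a<b) fb≤x)) (<-irrefl refl)
... | tri≈ _ a≡b _ = a≡b
... | tri> _ _ b<a = contradiction (<-≤-trans x<fb+1 (≤-trans (mono b<a) fa≤x)) (<-irrefl refl)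

-- Points of a range satisfying a predicate

range : ℕ → ℕ → List ℕ
range a zero    = []
range a (suc l) = suc a ∷ range (suc a) l

range-++ : ∀ a l m → range a (l + m) ≡ range a l ++ range (a + l) m
range-++ a zero    m = cong (λ b → range b m) (sym (+-identityʳ a))
range-++ a (suc l) m = cong (suc a ∷_)
  (trans (range-++ (suc a) l m) (cong (λ b → range (suc a) l ++ range b m) (sym (+-suc a l))))

applyUpTo-range : ∀ {f : ℕ → ℕ} a n → (∀ i → f i ≡ suc (a + i)) → applyUpTo f n ≡ range a n
applyUpTo-range a zero    f≗ = refl
applyUpTo-range a (suc n) f≗ = cong₂ _∷_ (trans (f≗ 0) (cong suc (+-identityʳ a)))
  (applyUpTo-range (suc a) n (λ i → trans (f≗ (suc i)) (cong suc (+-suc a i))))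

record FirstAfter (Pr : Pred ℕ 0ℓ) (a l : ℕ) : Set where
  field
    positive : 0 < l
    skipped  : ∀ {j} → 0 < j → j < l → ¬ Pr (a + j)
    hit      : Pr (a + l)

-- Gaps Pr a (l₁ ∷ l₂ ∷ …): the points of (a, a + l₁ + l₂ + ⋯] satisfying Pr are
-- a + l₁, a + l₁ + l₂, …
data Gaps (Pr : Pred ℕ 0ℓ) : ℕ → List ℕ → Set where
  []  : ∀ {a} → Gaps Pr a []
  _∷_ : ∀ {a l L} → FirstAfter Pr a l → Gaps Pr (a + l) L → Gaps Pr a (l ∷ L)

Gaps-positive : ∀ {Pr a L} → Gaps Pr a L → All (0 <_) L
Gaps-positive []             = []
Gaps-positive (first ∷ gaps) = FirstAfter.positive first ∷ Gaps-positive gaps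

FirstAfter-suc : ∀ {Pr a l} → FirstAfter Pr a (suc (suc l)) → FirstAfter Pr (suc a) (suc l)
FirstAfter-suc {Pr} {a} {l} first = record
  { positive = z<s
  ; skipped  = λ {j} _ j<l+1 → skipped z<s (s<s j<l+1) ∘ subst Pr (sym (+-suc a j))
  ; hit      = subst Pr (+-suc a (suc l)) hit
  }
  where open FirstAfter first

filter-range-FirstAfter : ∀ {Pr} (Pr? : Decidable Pr) {a l} → FirstAfter Pr a l →
  filter Pr? (range a l) ≡ a + l ∷ []
filter-range-FirstAfter {Pr} Pr? {a} {suc zero} first =
  trans (filter-accept Pr? (subst Pr (+-comm a 1) hit)) (cong (_∷ []) (+-comm 1 a))
  where open FirstAfter first
filter-range-FirstAfter {Pr} Pr? {a} {suc (suc l)} first =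
  trans (filter-reject Pr? (skipped z<s (s<s z<s) ∘ subst Pr (+-comm 1 a)))
    (trans (filter-range-FirstAfter Pr? (FirstAfter-suc first))
           (cong (_∷ []) (sym (+-suc a (suc l)))))
  where open FirstAfter first

diffsFrom-filter-range : ∀ {Pr} (Pr? : Decidable Pr) {a L} → Gaps Pr a L →
  diffsFrom a (filter Pr? (range a (sum L))) ≡ L
diffsFrom-filter-range Pr? []                         = refl
diffsFrom-filter-range Pr? {a} {l ∷ L} (first ∷ gaps) = begin
  diffsFrom a (filter Pr? (range a (l + sum L)))
    ≡⟨ cong (diffsFrom a ∘ filter Pr?) (range-++ a l (sum L)) ⟩
  diffsFrom a (filter Pr? (range a l ++ range (a + l) (sum L)))
    ≡⟨ cong (diffsFrom a) (filter-++ Pr? (range a l) (range (a + l) (sum L))) ⟩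
  diffsFrom a (filter Pr? (range a l) ++ rest)
    ≡⟨ cong (λ xs → diffsFrom a (xs ++ rest)) (filter-range-FirstAfter Pr? first) ⟩
  (a + l ∸ a) ∷ diffsFrom (a + l) rest
    ≡⟨ cong₂ _∷_ (m+n∸m≡n a l) (diffsFrom-filter-range Pr? gaps) ⟩
  l ∷ L ∎
  where
  open ≡-Reasoning
  rest = filter Pr? (range (a + l) (sum L))

applyFrom : (ℕ → A) → ℕ → ℕ → List A
applyFrom f a zero    = []
applyFrom f a (suc c) = f a ∷ applyFrom f (suc a) c

applyFrom-cong : ∀ {f g : ℕ → A} → (∀ a → f a ≡ g a) → ∀ a c → applyFrom f a c ≡ applyFrom g a c
applyFrom-cong f≗g a zero    = refl
applyFrom-cong f≗g a (suc c) = cong₂ _∷_ (f≗g a) (applyFrom-cong f≗g (suc a) c)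

applyFrom-injective : ∀ {f g : ℕ → A} a c c′ → applyFrom f a c ≡ applyFrom g a c′ →
  c ≡ c′ × (∀ {j} → j < c → f (a + j) ≡ g (a + j))
applyFrom-injective a zero    zero     _  = refl , λ ()
applyFrom-injective {f = f} {g} a (suc c) (suc c′) eq
  with fa≡ga , rest ← ∷-injective eq
  with c≡c′ , f≗g ← applyFrom-injective (suc a) c c′ rest = cong suc c≡c′ , pointwise
  where
  pointwise : ∀ {j} → j < suc c → f (a + j) ≡ g (a + j)
  pointwise {zero}  _         = subst (λ b → f b ≡ g b) (sym (+-identityʳ a)) fa≡ga
  pointwise {suc j} (s<s j<c) = subst (λ b → f b ≡ g b) (sym (+-suc a j)) (f≗g j<c)

length-prime : ∀ {r} → 0 < r → length (prime r) ≡ r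
length-prime {suc r} _ = cong suc (length-applyUpTo suc r)

map-length-prime : ∀ {L} → All (0 <_) L → map length (map prime L) ≡ L
map-length-prime []          = refl
map-length-prime (r>0 ∷ L>0) = cong₂ _∷_ (length-prime r>0) (map-length-prime L>0)

map-prime-injective : ∀ {L M} → All (0 <_) L → All (0 <_) M → map prime L ≡ map prime M → L ≡ M
map-prime-injective L>0 M>0 eq =
  trans (sym (map-length-prime L>0)) (trans (cong (map length) eq) (map-length-prime M>0))

-- The blocks of an ordered set partition

label : ℕ → ℕ → ℕ
label s zero    = s + 1
label s (suc r) = s + suc r

label-≤ : ∀ {s r m} → label s r ≤ m ⇔ (s + r < m ⊎ (s + r ≡ m × 0 < r))
label-≤ {s} {r} {m} = mk⇔ (to r) (from r)
  where
  to : ∀ r → label s r ≤ m → s + r < m ⊎ (s + r ≡ m × 0 < r)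
  to zero    s+1≤m = inj₁ (subst (_≤ m) (+-suc s 0) s+1≤m)
  to (suc r) s+r≤m = map₂ (_, z<s) (m≤n⇒m<n∨m≡n s+r≤m)
  from : ∀ r → s + r < m ⊎ (s + r ≡ m × 0 < r) → label s r ≤ m
  from zero    (inj₁ s<m)          = subst (_≤ m) (sym (+-suc s 0)) s<m
  from (suc r) (inj₁ s+r<m)        = <⇒≤ s+r<m
  from (suc r) (inj₂ (s+r≡m , _)) = ≤-reflexive s+r≡m

isBreakpoint? : ∀ {n} (α : Fin n → ℕ) → Decidable (isBreakpoint α)
isBreakpoint? α m = count (λ i → α i ≤ m) (λ i → α i ≤? m) ≟ m

-- Blocks are indexed from 0: for c in the block with index a, offset a and rank c are the
-- numbers s and t - 1 in the definition of ψ.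
module Blocks {n} (P : OSP n) where

  block : Fin n → ℕ
  block i = toℕ (blockOf P i)

  offset : ℕ → ℕ
  offset a = count (λ d → block d < a) (λ d → block d <? a)

  size : ℕ → ℕ
  size a = count (λ d → block d ≡ a) (λ d → block d ≟ a)

  EarlierInBlock : Fin n → Pred (Fin n) 0ℓ
  EarlierInBlock c d = block d ≡ block c × toℕ d < toℕ c

  earlierInBlock? : ∀ c → Decidable (EarlierInBlock c)
  earlierInBlock? c d = block d ≟ block c ×-dec toℕ d <? toℕ c

  rank : Fin n → ℕ
  rank c = count (EarlierInBlock c) (earlierInBlock? c)

  position : Fin n → ℕ
  position c = offset (block c) + rank c

  blockSizes : List ℕ
  blockSizes = applyFrom size 0 (k P)

  Breakpoint : Pred ℕ 0ℓ
  Breakpoint = isBreakpoint (ψ P)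

  ψ≡label : ∀ c → ψ P c ≡ label (offset (block c)) (rank c)
  ψ≡label c with offset (block c) | rank c
  ... | _ | zero  = refl
  ... | _ | suc _ = refl

  offset-zero : offset 0 ≡ 0
  offset-zero = count-none (λ d → block d <? 0) (λ _ ())

  offset-suc : ∀ a → offset (suc a) ≡ offset a + size a
  offset-suc a =
    count-disjoint-∪ (λ d → block d <? suc a) (λ d → block d <? a) (λ d → block d ≟ a)
      (m≤n⇒m<n∨m≡n ∘ s≤s⁻¹ , [ m<n⇒m<1+n , s≤s ∘ ≤-reflexive ]′)
      (λ (d<a , d≡a) → <-irrefl d≡a d<a)

  offset-mono : offset Preserves _≤_ ⟶ _≤_
  offset-mono a≤b =
    count-mono (λ d → block d <? _) (λ d → block d <? _) (λ d<a → <-≤-trans d<a a≤b)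

  offset-≤ : ∀ a → offset a ≤ n
  offset-≤ a = count-≤ (λ d → block d <? a)

  offset-k : offset (k P) ≡ n
  offset-k = count-all (λ d → block d <? k P) (λ d → toℕ<n (blockOf P d))

  size-pos : ∀ {a} → a < k P → 0 < size a
  size-pos a<k with d , d↦a ← surjective P (fromℕ< a<k) =
    count-pos (λ d → block d ≟ _) (trans (cong toℕ d↦a) (toℕ-fromℕ< a<k))

  size-beyond : ∀ {a} → k P ≤ a → size a ≡ 0
  size-beyond k≤a = count-none (λ d → block d ≟ _)
    (λ d d≡a → <-irrefl d≡a (<-≤-trans (toℕ<n (blockOf P d)) k≤a))

  rank<size : ∀ c → rank c < size (block c)
  rank<size c = count-strict (earlierInBlock? c) (λ d → block d ≟ block c) proj₁ {c} refl
    (λ (_ , c<c) → <-irrefl refl c<c)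

  rank-< : ∀ {i j} → block i ≡ block j → toℕ i < toℕ j → rank i < rank j
  rank-< {i} {j} i~j i<j = count-strict (earlierInBlock? i) (earlierInBlock? j)
    (λ (d~i , d<i) → trans d~i i~j , <-trans d<i i<j) {i} (i~j , i<j)
    (λ (_ , i<i) → <-irrefl refl i<i)

  rank-injective : ∀ {i j} → block i ≡ block j → rank i ≡ rank j → i ≡ j
  rank-injective {i} {j} i~j ri≡rj with <-cmp (toℕ i) (toℕ j)
  ... | tri< i<j _ _ = contradiction ri≡rj (<⇒≢ (rank-< i~j i<j))
  ... | tri≈ _ i≡j _ = toℕ-injective i≡j
  ... | tri> _ _ j<i = contradiction (sym ri≡rj) (<⇒≢ (rank-< (sym i~j) j<i))

  offset≤position : ∀ c → offset (block c) ≤ position c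
  offset≤position c = m≤m+n _ _

  offset+<offset-suc : ∀ {a j} → j < size a → offset a + j < offset (suc a)
  offset+<offset-suc {a} {j} j<size =
    subst (offset a + j <_) (sym (offset-suc a)) (+-monoʳ-< (offset a) j<size)

  position<offset : ∀ c → position c < offset (suc (block c))
  position<offset c = offset+<offset-suc (rank<size c)

  position<n : ∀ c → position c < n
  position<n c = <-≤-trans (position<offset c) (offset-≤ _)

  block-unique : ∀ {a} c → offset a ≤ position c → position c < offset (suc a) → block c ≡ a
  block-unique c = step-unique offset-mono (offset≤position c) (position<offset c)

  position≡offset+ : ∀ {a j} c → j < size a → position c ≡ offset a + j → block c ≡ a × rank c ≡ j
  position≡offset+ {a} {j} c j<size c↦ = c∈a , +-cancelˡ-≡ (offset a) _ _ (begin
    offset a + rank c         ≡⟨ cong (λ b → offset b + rank c) c∈a ⟨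
    position c                ≡⟨ c↦ ⟩
    offset a + j              ∎)
    where
    open ≡-Reasoning
    c∈a : block c ≡ a
    c∈a = block-unique c (subst (offset a ≤_) (sym c↦) (m≤m+n _ _))
      (subst (_< offset (suc a)) (sym c↦) (offset+<offset-suc j<size))

  position-injective : Injective _≡_ _≡_ position
  position-injective {i} {j} pi≡pj =
    rank-injective i~j (proj₂ (position≡offset+ i (rank<size j) pi≡pj))
    where
    i~j : block i ≡ block j
    i~j = proj₁ (position≡offset+ i (rank<size j) pi≡pj)

  ranking : Permutation′ n
  ranking = injection⇒permutation (λ c → fromℕ< (position<n c))
    (position-injective ∘ fromℕ<-injective _ _ (position<n _) (position<n _))

  toℕ-ranking : ∀ c → toℕ (ranking ⟨$⟩ʳ c) ≡ position c
  toℕ-ranking c = toℕ-fromℕ< (position<n c)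

  position-surjective : ∀ {m} → m < n → ∃ λ c → position c ≡ m
  position-surjective m<n = c , (begin
    position c            ≡⟨ toℕ-ranking c ⟨
    toℕ (ranking ⟨$⟩ʳ c)   ≡⟨ cong toℕ (inverseʳ ranking) ⟩
    toℕ (fromℕ< m<n)      ≡⟨ toℕ-fromℕ< m<n ⟩
    _                     ∎)
    where
    open ≡-Reasoning
    c = ranking ⟨$⟩ˡ fromℕ< m<n

  count-position< : ∀ {m} → m ≤ n → count (λ c → position c < m) (λ c → position c <? m) ≡ m
  count-position< {m} m≤n = begin
    count (λ c → position c < m) (λ c → position c <? m)
      ≡⟨ count-cong _ (λ c → toℕ (ranking ⟨$⟩ʳ c) <? m)
           (subst (_< m) (sym (toℕ-ranking _)) , subst (_< m) (toℕ-ranking _)) ⟩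
    count (λ c → toℕ (ranking ⟨$⟩ʳ c) < m) (λ c → toℕ (ranking ⟨$⟩ʳ c) <? m)
      ≡⟨ count-permute (λ i → toℕ i <? m) ranking ⟩
    count (λ (i : Fin n) → toℕ i < m) (λ i → toℕ i <? m)
      ≡⟨ count-toℕ< m≤n ⟩
    m ∎
    where open ≡-Reasoning

  NonLeastAt : ℕ → Pred (Fin n) 0ℓ
  NonLeastAt m c = position c ≡ m × 0 < rank c

  nonLeastAt? : ∀ m → Decidable (NonLeastAt m)
  nonLeastAt? m c = position c ≟ m ×-dec 0 <? rank c

  count-ψ≤ : ∀ {m} → m ≤ n →
    count (λ c → ψ P c ≤ m) (λ c → ψ P c ≤? m) ≡ m + count (NonLeastAt m) (nonLeastAt? m)
  count-ψ≤ {m} m≤n = begin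
    count (λ c → ψ P c ≤ m) (λ c → ψ P c ≤? m)
      ≡⟨ count-disjoint-∪ _ (λ c → position c <? m) (nonLeastAt? m) (split , merge)
           (λ (c<m , c≡m , _) → <-irrefl c≡m c<m) ⟩
    count (λ c → position c < m) (λ c → position c <? m) + nonLeast
      ≡⟨ cong (_+ nonLeast) (count-position< m≤n) ⟩
    m + nonLeast ∎
    where
    open ≡-Reasoning
    nonLeast = count (NonLeastAt m) (nonLeastAt? m)
    split : ∀ {c} → ψ P c ≤ m → position c < m ⊎ NonLeastAt m c
    split {c} = Equivalence.to label-≤ ∘ subst (_≤ m) (ψ≡label c)
    merge : ∀ {c} → position c < m ⊎ NonLeastAt m c → ψ P c ≤ m
    merge {c} = subst (_≤ m) (sym (ψ≡label c)) ∘ Equivalence.from label-≤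

  ¬breakpoint-inside : ∀ {a j} → 0 < j → j < size a → ¬ Breakpoint (offset a + j)
  ¬breakpoint-inside {a} {j} j>0 j<size breakpoint =
    <-irrefl (trans (sym breakpoint) (count-ψ≤ (<⇒≤ m<n)))
      (m<m+n m (count-pos (nonLeastAt? m) nonLeast))
    where
    m = offset a + j
    m<n : m < n
    m<n = <-≤-trans (offset+<offset-suc j<size) (offset-≤ (suc a))
    at-m = position-surjective m<n
    nonLeast : NonLeastAt m (proj₁ at-m)
    nonLeast = proj₂ at-m
      , subst (0 <_) (sym (proj₂ (position≡offset+ (proj₁ at-m) j<size (proj₂ at-m)))) j>0

  breakpoint-end : ∀ a → Breakpoint (offset (suc a))
  breakpoint-end a = begin
    count (λ c → ψ P c ≤ m) (λ c → ψ P c ≤? m) ≡⟨ count-ψ≤ (offset-≤ _) ⟩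
    m + count (NonLeastAt m) (nonLeastAt? m)   ≡⟨ cong (m +_) (count-none _ ¬nonLeast) ⟩
    m + 0                                      ≡⟨ +-identityʳ m ⟩
    m                                          ∎
    where
    open ≡-Reasoning
    m = offset (suc a)
    ¬nonLeast : ∀ c → ¬ NonLeastAt m c
    ¬nonLeast c (c↦m , rank>0) with block c ≤? a
    ... | yes c≤a = <-irrefl c↦m (<-≤-trans (position<offset c) (offset-mono (s≤s c≤a)))
    ... | no  c≰a = <-irrefl (sym c↦m) (≤-<-trans (offset-mono (≰⇒> c≰a)) (m<m+n _ rank>0))

  firstAfter-offset : ∀ {a} → a < k P → FirstAfter Breakpoint (offset a) (size a)
  firstAfter-offset {a} a<k = record
    { positive = size-pos a<k
    ; skipped  = ¬breakpoint-inside
    ; hit      = subst Breakpoint (offset-suc a) (breakpoint-end a)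
    }

  gaps-offset : ∀ a c → a + c ≡ k P → Gaps Breakpoint (offset a) (applyFrom size a c)
  gaps-offset a zero    _       = []
  gaps-offset a (suc c) a+c+1≡k = firstAfter-offset (subst (a <_) a+c+1≡k (m<m+n a z<s))
    ∷ subst (λ b → Gaps Breakpoint b (applyFrom size (suc a) c)) (offset-suc a)
            (gaps-offset (suc a) c (trans (sym (+-suc a c)) a+c+1≡k))

  offset+sum : ∀ a c → offset a + sum (applyFrom size a c) ≡ offset (a + c)
  offset+sum a zero    = trans (+-identityʳ _) (cong offset (sym (+-identityʳ a)))
  offset+sum a (suc c) = begin
    offset a + (size a + rest) ≡⟨ +-assoc (offset a) _ _ ⟨
    offset a + size a + rest   ≡⟨ cong (_+ rest) (offset-suc a) ⟨
    offset (suc a) + rest      ≡⟨ offset+sum (suc a) c ⟩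
    offset (suc a + c)         ≡⟨ cong offset (+-suc a c) ⟨
    offset (a + suc c)         ∎
    where
    open ≡-Reasoning
    rest = sum (applyFrom size (suc a) c)

  blockSizes-gaps : Gaps Breakpoint 0 blockSizes
  blockSizes-gaps =
    subst (λ b → Gaps Breakpoint b blockSizes) offset-zero (gaps-offset 0 (k P) refl)

  sum-blockSizes : sum blockSizes ≡ n
  sum-blockSizes =
    trans (cong (_+ sum blockSizes) (sym offset-zero)) (trans (offset+sum 0 (k P)) offset-k)

  primeLengths≡blockSizes : primeLengths (ψ P) ≡ blockSizes
  primeLengths≡blockSizes = begin
    diffsFrom 0 (filter (isBreakpoint? (ψ P)) (applyUpTo suc n))
      ≡⟨ cong (diffsFrom 0 ∘ filter (isBreakpoint? (ψ P))) (applyUpTo-range 0 n (λ _ → refl)) ⟩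
    diffsFrom 0 (filter (isBreakpoint? (ψ P)) (range 0 n))
      ≡⟨ cong (diffsFrom 0 ∘ filter (isBreakpoint? (ψ P)) ∘ range 0) sum-blockSizes ⟨
    diffsFrom 0 (filter (isBreakpoint? (ψ P)) (range 0 (sum blockSizes)))
      ≡⟨ diffsFrom-filter-range (isBreakpoint? (ψ P)) blockSizes-gaps ⟩
    blockSizes ∎
    where open ≡-Reasoning

-- Orbits

open Blocks using (blockSizes)

orderedPrimeDecomposition-ψ : ∀ {n} (P : OSP n) →
  orderedPrimeDecomposition (ψ P) ≡ map prime (blockSizes P)
orderedPrimeDecomposition-ψ P = cong (map prime) (Blocks.primeLengths≡blockSizes P)

blockSizes-positive : ∀ {n} (P : OSP n) → All (0 <_) (blockSizes P)
blockSizes-positive P = Gaps-positive (Blocks.blockSizes-gaps P)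

sameOrbit⇒blockSizes≡ : ∀ {n} {P Q : OSP n} → SameOrbit P Q → blockSizes P ≡ blockSizes Q
sameOrbit⇒blockSizes≡ {P = P} {Q} (σ , kP≡kQ , σP≈Q) =
  trans (applyFrom-cong size≡ 0 (k P)) (cong (applyFrom BQ.size 0) kP≡kQ)
  where
  module BP = Blocks P
  module BQ = Blocks Q
  size≡ : ∀ a → BP.size a ≡ BQ.size a
  size≡ a = trans (sym (count-permute (λ i → BP.block i ≟ a) (flip σ)))
    (count-cong _ (λ j → BQ.block j ≟ a) (trans (sym (σP≈Q _)) , trans (σP≈Q _)))

blockSizes≡⇒offset≡ : ∀ {n} {P Q : OSP n} → blockSizes P ≡ blockSizes Q →
  ∀ a → Blocks.offset P a ≡ Blocks.offset Q a
blockSizes≡⇒offset≡ {P = P} {Q} sizes≡ = offset≡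
  where
  module BP = Blocks P
  module BQ = Blocks Q
  k≡,size≡ = applyFrom-injective 0 (k P) (k Q) sizes≡
  size≡ : ∀ a → BP.size a ≡ BQ.size a
  size≡ a with a <? k P
  ... | yes a<k = proj₂ k≡,size≡ a<k
  ... | no  a≮k = trans (BP.size-beyond (≮⇒≥ a≮k))
    (sym (BQ.size-beyond (subst (_≤ a) (proj₁ k≡,size≡) (≮⇒≥ a≮k))))
  offset≡ : ∀ a → BP.offset a ≡ BQ.offset a
  offset≡ zero    = trans BP.offset-zero (sym BQ.offset-zero)
  offset≡ (suc a) =
    trans (BP.offset-suc a) (trans (cong₂ _+_ (offset≡ a) (size≡ a)) (sym (BQ.offset-suc a)))

blockSizes≡⇒sameOrbit : ∀ {n} {P Q : OSP n} → blockSizes P ≡ blockSizes Q → SameOrbit P Q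
blockSizes≡⇒sameOrbit {n} {P} {Q} sizes≡ =
  σ , proj₁ (applyFrom-injective 0 (k P) (k Q) sizes≡) , block≡
  where
  module BP = Blocks P
  module BQ = Blocks Q
  offset≡ = blockSizes≡⇒offset≡ {P = P} {Q} sizes≡
  σ : Permutation′ n
  σ = BP.ranking ∘ₚ flip BQ.ranking
  block≡ : ∀ j → BP.block (σ ⟨$⟩ˡ j) ≡ BQ.block j
  block≡ j = BP.block-unique i
    (subst₂ _≤_ (sym (offset≡ (BQ.block j))) (sym i↦j) (BQ.offset≤position j))
    (subst₂ _<_ (sym i↦j) (sym (offset≡ (suc (BQ.block j)))) (BQ.position<offset j))
    where
    i = σ ⟨$⟩ˡ j
    i↦j : BP.position i ≡ BQ.position j
    i↦j = trans (sym (BP.toℕ-ranking i))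
      (trans (cong toℕ (inverseʳ BP.ranking)) (BQ.toℕ-ranking j))

lemma3p12 : (n : ℕ) → (P Q : OSP n) →
    (SameOrbit P Q → orderedPrimeDecomposition (ψ P) ≡ orderedPrimeDecomposition (ψ Q))
    × (orderedPrimeDecomposition (ψ P) ≡ orderedPrimeDecomposition (ψ Q) → SameOrbit P Q)
lemma3p12 n P Q rewrite orderedPrimeDecomposition-ψ P | orderedPrimeDecomposition-ψ Q =
    (λ orbit → cong (map prime) (sameOrbit⇒blockSizes≡ {P = P} {Q} orbit))
  , (λ primes≡ → blockSizes≡⇒sameOrbit {P = P} {Q}
       (map-prime-injective (blockSizes-positive P) (blockSizes-positive Q) primes≡))
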